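{- Let $F\colon\mathbb{B}\to\Sigma$ be a Sudoku solution and let $A,B,C,D\in\mathbb{Z}/q\mathbb{Z}$ with $B$ odd be such that $F(n,m)=\Psi(n,m)$ for all $(n,m)\in\mathbb{B}$ with $\Psi(n,m)\neq0$, where $\Psi(n,m)=An+Bm+C+D\frac q4m(m-n)$. Then there exist integers $A',B',C'$ with $B'$ odd such that the shearing $F'(n,m)=B'F(n,m+A'n+C')$ is in normal form: there exists $D'\in\mathbb{Z}/q\mathbb{Z}$ with $F'(n,m)=m+D'\frac q4m(m-n)$ for all $n\in\{1,\dots,N\}$ and all $m\in\mathbb{Z}\setminus q\mathbb{Z}$.
   Context: $q=2^{s_0}$ is a fixed, sufficiently large power of two, $N=q^2$, $\Sigma=(\mathbb{Z}/q\mathbb{Z})\setminus\{0\}$, $\mathbb{B}=\{1,\dots,N\}\times\mathbb{Z}$. $f_q\colon\mathbb{Z}\to\Sigma$: $f_q(q^km)=m\bmod q$ for $k\ge0$, $m$ not divisible by $q$; $f_q(0)=1$. $\mathcal{S}[N]$: functions $g\colon\{1,\dots,N\}\to\Sigma$ of the form $g(n)=cf_q(an+b)$, $a,b,c\in\mathbb{Z}$, $c$ odd. A Sudoku solution is $F\colon\mathbb{B}\to\Sigma$ with $n\mapsto F(n,jn+i)$ in $\mathcal{S}[N]$ for all $i,j\in\mathbb{Z}$. Here $\frac q4$ is the integer $q/4$ and all arithmetic of values is in $\mathbb{Z}/q\mathbb{Z}$. -}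

module Defs where

open import Data.Nat as ℕ using (ℕ; zero; suc; _^_; _∸_; NonZero)
open import Data.Nat.Properties using (m^n≢0)
open import Data.Integer using (ℤ; +_; _+_; _-_; _*_; ∣_∣)
open import Data.Integer.DivMod using (_/ℕ_; _%ℕ_)
open import Data.Integer.Divisibility using (_∣_)
open import Data.Product using (Σ; ∃; _×_)
open import Relation.Nullary using (¬_)

Q : ℕ → ℕ
Q s = 2 ^ s

Q-nonZero : ∀ s → NonZero (Q s)
Q-nonZero s = m^n≢0 2 s

-- the integer q/4 = 2^(s-2)  (meaningful for s ≥ 2)
Qquarter : ℕ → ℤ
Qquarter s = + (2 ^ (s ∸ 2))

NN : ℕ → ℕ
NN s = Q s ℕ.* Q s

infix 4 _≡_[mod_]
_≡_[mod_] : ℤ → ℤ → ℕ → Set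
a ≡ b [mod q ] = (+ q) ∣ (a - b)

Odd : ℤ → Set
Odd c = ¬ ((+ 2) ∣ c)

-- strip factors of q (fuel-bounded; the fuel ∣ x ∣ is never exhausted for x ≠ 0, q ≥ 2)
strip : ℕ → (q : ℕ) → .{{_ : NonZero q}} → ℤ → ℤ
strip zero    q x = + 1
strip (suc k) q x with x %ℕ q
... | zero  = strip k q (x /ℕ q)
... | suc r = + suc r

-- f_q(q^k m) = m mod q  (m not divisible by q),  f_q(0) = 1  (value as representative in [0,q))
fq : (q : ℕ) → .{{_ : NonZero q}} → ℤ → ℤ
fq q (+ zero) = + 1
fq q x        = strip ∣ x ∣ q x

-- F : 𝔹 → Σ is a Sudoku solution (F given on ℕ × ℤ; only n ∈ {1,…,N} matters).
-- Values are integer representatives of residues mod q.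
SudokuSolution : (s : ℕ) → (ℕ → ℤ → ℤ) → Set
SudokuSolution s F =
  (∀ n m → 1 ℕ.≤ n → n ℕ.≤ NN s → ¬ (F n m ≡ + 0 [mod Q s ]))
  × (∀ (i j : ℤ) → ∃ λ a → ∃ λ b → ∃ λ c → Odd c ×
       (∀ n → 1 ℕ.≤ n → n ℕ.≤ NN s →
          F n (j * + n + i) ≡ c * fq (Q s) {{Q-nonZero s}} (a * + n + b) [mod Q s ]))

Ψ : (s : ℕ) → (A B C D : ℤ) → ℕ → ℤ → ℤ
Ψ s A B C D n m = A * + n + B * m + C + D * Qquarter s * m * (m - + n)

-- Write r = q/4.  Since B is a unit modulo q = 2^s, we may divide Ψ by B and
-- get a n + m + c + E r m (m − n) with a = A/B, c = C/B, E = D/B.  Substitute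
-- m ↦ m − a n − c + r (α n + γ).  As r² ≡ 0 (mod q), the quadratic term now only
-- matters modulo 4, where (m − a n − c)(m − a n − c − n) is (1 + 2a) m (m − n)
-- plus a term linear in m and a term affine in n (both because x² − x is even).
-- The affine term is cancelled by the choice of α, γ; the linear one is absorbed
-- by the unit factor 1 + β r, since (1 + β r)(m − r β m) ≡ m.  The resulting
-- normal form is nonzero modulo q whenever m is, so the hypothesis on F applies
-- at every shifted point.
module Submission where

open import Defs
open import Data.Nat using (ℕ; _≤_)
open import Data.Integer using (ℤ; +_; _+_; _-_; _*_)
open import Data.Product using (Σ; ∃; _×_)
open import Relation.Nullary using (¬_)
open import Data.Integer.Divisibility using (_∣_)

open import Data.Nat as ℕ using (suc; s≤s; z≤n; _^_)
import Data.Nat.Properties as ℕ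
import Data.Nat.Divisibility as ℕ
open import Data.Nat.Primality using (prime?; euclidsLemma)
open import Data.Integer using (-_; ∣_∣; _%ℕ_; _/ℕ_)
import Data.Integer.Properties as ℤ
open import Data.Integer.DivMod using (a≡a%ℕn+[a/ℕn]*n; n%ℕd<d)
open import Data.Integer.Divisibility.Signed
  using (divides; ∣ᵤ⇒∣; ∣⇒∣ᵤ; ∣-refl; ∣-trans; ∣m∣n⇒∣m+n; ∣m⇒∣-m; ∣m+n∣n⇒∣m;
         ∣m⇒∣m*n; ∣n⇒∣m*n; *-monoˡ-∣; *-monoʳ-∣)
  renaming (_∣_ to _∣ₛ_)
open import Data.Integer.Tactic.RingSolver using (solve-∀)
open import Data.Product using (_,_)
open import Data.Sum using (_⊎_; inj₁; inj₂; [_,_]′)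
open import Level using (0ℓ)
open import Relation.Binary.Bundles using (Setoid)
open import Relation.Binary.PropositionalEquality
  using (_≡_; refl; sym; trans; cong; subst)
open import Relation.Nullary.Decidable using (from-yes)
open import Relation.Nullary.Negation using (contradiction)

-- Ψ s A B C D n m unfolds to ψ (Qquarter s) A B C D (+ n) m.
ψ : (r A B C D n m : ℤ) → ℤ
ψ r A B C D n m = A * n + B * m + C + D * r * m * (m - n)

*-pres-∣ₛ : ∀ {i j k l} → i ∣ₛ j → k ∣ₛ l → i * k ∣ₛ j * l
*-pres-∣ₛ {j = j} {k} i∣j k∣l = ∣-trans (*-monoˡ-∣ k i∣j) (*-monoʳ-∣ j k∣l)

-- A record copy of _≡_[mod_] with signed divisibility, so that a and b can be
-- inferred from the type.
infix 4 _≡_⟨mod_⟩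
record _≡_⟨mod_⟩ (a b : ℤ) (q : ℕ) : Set where
  constructor ⟨mod⟩
  field ∣-difference : + q ∣ₛ a - b

⟨mod⟩⇒[mod] : ∀ {q a b} → a ≡ b ⟨mod q ⟩ → a ≡ b [mod q ]
⟨mod⟩⇒[mod] (⟨mod⟩ q∣a-b) = ∣⇒∣ᵤ q∣a-b

[mod]⇒⟨mod⟩ : ∀ {q a b} → a ≡ b [mod q ] → a ≡ b ⟨mod q ⟩
[mod]⇒⟨mod⟩ q∣a-b = ⟨mod⟩ (∣ᵤ⇒∣ q∣a-b)

module _ {q : ℕ} where

  ≡-mod-by : ∀ {a b} e → a - b ≡ e → + q ∣ₛ e → a ≡ b ⟨mod q ⟩
  ≡-mod-by e a-b≡e q∣e = ⟨mod⟩ (subst (+ q ∣ₛ_) (sym a-b≡e) q∣e)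

  ≡⇒≡-mod : ∀ {a b} → a ≡ b → a ≡ b ⟨mod q ⟩
  ≡⇒≡-mod {a} refl = ≡-mod-by (+ 0 * + q) (ℤ.+-inverseʳ a) (divides (+ 0) refl)

  ≡-mod-sym : ∀ {a b} → a ≡ b ⟨mod q ⟩ → b ≡ a ⟨mod q ⟩
  ≡-mod-sym {a} {b} (⟨mod⟩ q∣a-b) = ≡-mod-by _ (lemma a b) (∣m⇒∣-m q∣a-b)
    where
    lemma : ∀ a b → b - a ≡ - (a - b)
    lemma = solve-∀

  ≡-mod-trans : ∀ {a b c} → a ≡ b ⟨mod q ⟩ → b ≡ c ⟨mod q ⟩ → a ≡ c ⟨mod q ⟩
  ≡-mod-trans {a} {b} {c} (⟨mod⟩ q∣a-b) (⟨mod⟩ q∣b-c) =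
    ≡-mod-by _ (lemma a b c) (∣m∣n⇒∣m+n q∣a-b q∣b-c)
    where
    lemma : ∀ a b c → a - c ≡ (a - b) + (b - c)
    lemma = solve-∀

  +-congˡ-mod : ∀ a {b c} → b ≡ c ⟨mod q ⟩ → a + b ≡ a + c ⟨mod q ⟩
  +-congˡ-mod a {b} {c} (⟨mod⟩ q∣b-c) = ≡-mod-by _ (lemma a b c) q∣b-c
    where
    lemma : ∀ a b c → (a + b) - (a + c) ≡ b - c
    lemma = solve-∀

  +-congʳ-mod : ∀ {a b} c → a ≡ b ⟨mod q ⟩ → a + c ≡ b + c ⟨mod q ⟩
  +-congʳ-mod {a} {b} c (⟨mod⟩ q∣a-b) = ≡-mod-by _ (lemma a b c) q∣a-b
    where
    lemma : ∀ a b c → (a + c) - (b + c) ≡ a - b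
    lemma = solve-∀

  *-congˡ-mod : ∀ a {b c} → b ≡ c ⟨mod q ⟩ → a * b ≡ a * c ⟨mod q ⟩
  *-congˡ-mod a {b} {c} (⟨mod⟩ q∣b-c) = ≡-mod-by _ (lemma a b c) (∣n⇒∣m*n a q∣b-c)
    where
    lemma : ∀ a b c → a * b - a * c ≡ a * (b - c)
    lemma = solve-∀

  +-multiple-mod : ∀ a {x} → + q ∣ₛ x → a + x ≡ a ⟨mod q ⟩
  +-multiple-mod a {x} q∣x = ≡-mod-by x (lemma a x) q∣x
    where
    lemma : ∀ a x → (a + x) - a ≡ x
    lemma = solve-∀

≡-mod-setoid : ℕ → Setoid 0ℓ 0ℓ
≡-mod-setoid q = record
  { Carrier       = ℤ
  ; _≈_           = _≡_⟨mod q ⟩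
  ; isEquivalence = record
    { refl  = ≡⇒≡-mod refl
    ; sym   = ≡-mod-sym
    ; trans = ≡-mod-trans
    }
  }

module ≡-mod-Reasoning (q : ℕ) where
  open import Relation.Binary.Reasoning.Setoid (≡-mod-setoid q) public

≡-mod-∣ : ∀ {d q a b} → + d ∣ₛ + q → a ≡ b ⟨mod q ⟩ → a ≡ b ⟨mod d ⟩
≡-mod-∣ d∣q (⟨mod⟩ q∣a-b) = ⟨mod⟩ (∣-trans d∣q q∣a-b)

even-or-odd : ∀ n → + 2 ∣ₛ n ⊎ + 2 ∣ₛ n - + 1
even-or-odd n with n %ℕ 2 | n%ℕd<d n 2 | a≡a%ℕn+[a/ℕn]*n n 2
... | 0           | _              | n≡ = inj₁ (divides (n /ℕ 2) (trans n≡ (ℤ.+-identityˡ _)))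
... | 1           | _              | n≡ = inj₂ (divides (n /ℕ 2) (trans (cong (_- + 1) n≡) (lemma _)))
  where
  lemma : ∀ x → + 1 + x - + 1 ≡ x
  lemma = solve-∀
... | suc (suc _) | s≤s (s≤s ()) | _

2∣n*n-n : ∀ n → + 2 ∣ₛ n * n - n
2∣n*n-n n = subst (+ 2 ∣ₛ_) (lemma n) ([ ∣m⇒∣m*n (n - + 1) , ∣n⇒∣m*n n ]′ (even-or-odd n))
  where
  lemma : ∀ n → n * (n - + 1) ≡ n * n - n
  lemma = solve-∀

Odd-1 : Odd (+ 1)
Odd-1 2∣1 with ℕ.∣1⇒≡1 2∣1
... | ()

Odd⇒≡1-mod-2 : ∀ {b} → Odd b → b ≡ + 1 ⟨mod 2 ⟩
Odd⇒≡1-mod-2 {b} odd = [ (λ 2∣b → contradiction (∣⇒∣ᵤ 2∣b) odd) , ⟨mod⟩ ]′ (even-or-odd b)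

Odd-≡-mod : ∀ {q a b} → + 2 ∣ₛ + q → a ≡ b ⟨mod q ⟩ → Odd b → Odd a
Odd-≡-mod {a = a} {b} 2∣q a≡b odd 2∣a with ≡-mod-∣ 2∣q a≡b
... | ⟨mod⟩ 2∣a-b =
  odd (∣⇒∣ᵤ (subst (+ 2 ∣ₛ_) (lemma a b) (∣m∣n⇒∣m+n (∣ᵤ⇒∣ {i = a} 2∣a) (∣m⇒∣-m 2∣a-b))))
  where
  lemma : ∀ a b → a + - (a - b) ≡ b
  lemma = solve-∀

Odd-* : ∀ {a b} → Odd a → Odd b → Odd (a * b)
Odd-* {a} {b} odd-a odd-b 2∣ab =
  [ odd-a , odd-b ]′ (euclidsLemma ∣ a ∣ ∣ b ∣ (from-yes (prime? 2)) (subst (2 ℕ.∣_) (ℤ.abs-* a b) 2∣ab))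

Odd-*-cancelˡ : ∀ {a b} → Odd (a * b) → Odd b
Odd-*-cancelˡ {a} {b} odd 2∣b = odd (subst (2 ℕ.∣_) (sym (ℤ.abs-* a b)) (ℕ.∣n⇒∣m*n ∣ a ∣ 2∣b))

-- Newton iteration X ↦ X (2 − B X): the defect B X − 1 gets squared.
inverse-lift : ∀ {d} B X → + 2 ∣ₛ + d → B * X ≡ + 1 ⟨mod d ⟩ →
               B * (X * (+ 2 - B * X)) ≡ + 1 ⟨mod 2 ℕ.* d ⟩
inverse-lift {d} B X 2∣d (⟨mod⟩ d∣defect) =
  ≡-mod-by _ (lemma B X) (∣m⇒∣-m (subst (_∣ₛ _) (sym (ℤ.pos-* 2 d)) 2d∣defect²))
  where
  2d∣defect² : + 2 * + d ∣ₛ (B * X - + 1) * (B * X - + 1)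
  2d∣defect² = *-pres-∣ₛ (∣-trans 2∣d d∣defect) d∣defect
  lemma : ∀ B X → B * (X * (+ 2 - B * X)) - + 1 ≡ - ((B * X - + 1) * (B * X - + 1))
  lemma = solve-∀

2∣2^suc : ∀ k → + 2 ∣ₛ + (2 ^ suc k)
2∣2^suc k = divides (+ (2 ^ k)) (trans (ℤ.pos-* 2 (2 ^ k)) (ℤ.*-comm (+ 2) (+ (2 ^ k))))

odd⇒invertible : ∀ {B} → Odd B → ∀ k → ∃ λ X → B * X ≡ + 1 ⟨mod 2 ^ suc k ⟩
odd⇒invertible {B} odd 0       = + 1 , ≡-mod-trans (≡⇒≡-mod (ℤ.*-identityʳ B)) (Odd⇒≡1-mod-2 odd)
odd⇒invertible {B} odd (suc k) with odd⇒invertible {B} odd k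
... | X , BX≡1 = X * (+ 2 - B * X) , inverse-lift B X (2∣2^suc k) BX≡1

shifted-square-mod-4 : ∀ a c m n →
  (m - a * n - c) * ((m - a * n - c) - n)
    ≡ (+ 1 + + 2 * a) * (m * (m - n)) - + 2 * (a + c) * m
      + ((a * a + a + + 2 * a * c + c) * n + c * c) ⟨mod 4 ⟩
shifted-square-mod-4 a c m n = ≡-mod-by _ (lemma a c m n)
  (∣m∣n⇒∣m+n (*-pres-∣ₛ (2∣n*n-n a) (2∣n*n-n n))
              (*-pres-∣ₛ (divides a (lemma₂ a)) (∣m∣n⇒∣m+n (2∣n*n-n n) (∣m⇒∣-m (2∣n*n-n m)))))
  where
  lemma : ∀ a c m n →
    (m - a * n - c) * ((m - a * n - c) - n)
      - ((+ 1 + + 2 * a) * (m * (m - n)) - + 2 * (a + c) * m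
         + ((a * a + a + + 2 * a * c + c) * n + c * c))
    ≡ (a * a - a) * (n * n - n) + (a + a) * ((n * n - n) + - (m * m - m))
  lemma = solve-∀
  lemma₂ : ∀ a → a + a ≡ a * + 2
  lemma₂ = solve-∀

-- r is the paper's q/4; 4 ∣ r holds for q = 2^s with s ≥ 4.
module Quarter {q : ℕ} {r : ℤ} (q≡4r : + q ≡ + 4 * r) (4∣r : + 4 ∣ₛ r) where

  r∣q : r ∣ₛ + q
  r∣q = divides (+ 4) q≡4r

  q∣r*r : + q ∣ₛ r * r
  q∣r*r = subst (_∣ₛ r * r) (sym q≡4r) (*-monoˡ-∣ r 4∣r)

  2∣r : + 2 ∣ₛ r
  2∣r = ∣-trans (divides (+ 2) refl) 4∣r

  2∣q : + 2 ∣ₛ + q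
  2∣q = ∣-trans 2∣r r∣q

  r*-mod-4 : ∀ {x y} → x ≡ y ⟨mod 4 ⟩ → r * x ≡ r * y ⟨mod q ⟩
  r*-mod-4 {x} {y} (⟨mod⟩ 4∣x-y) =
    ≡-mod-by _ (lemma r x y) (subst (_∣ₛ r * (x - y)) q≡r*4 (*-monoʳ-∣ r 4∣x-y))
    where
    q≡r*4 : r * + 4 ≡ + q
    q≡r*4 = sym (trans q≡4r (ℤ.*-comm (+ 4) r))
    lemma : ∀ r x y → r * x - r * y ≡ r * (x - y)
    lemma = solve-∀

  normal-form-≢0 : ∀ D n m → ¬ (+ q ∣ m) → ¬ (m + D * r * m * (m - n) ≡ + 0 ⟨mod q ⟩)
  normal-form-≢0 D n m q∤m (⟨mod⟩ q∣T-0) = q∤m (∣⇒∣ᵤ {i = m} (∣m+n∣n⇒∣m q∣T q∣tail))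
    where
    q∣T : + q ∣ₛ m + D * r * m * (m - n)
    q∣T = subst (+ q ∣ₛ_) (ℤ.+-identityʳ _) q∣T-0
    r∣m : r ∣ₛ m
    r∣m = ∣m+n∣n⇒∣m (∣-trans r∣q q∣T) (∣m⇒∣m*n (m - n) (∣m⇒∣m*n m (∣n⇒∣m*n D ∣-refl)))
    lemma : ∀ D r k m n → r * r * (D * k * (m - n)) ≡ D * r * (k * r) * (m - n)
    lemma = solve-∀
    q∣tail : + q ∣ₛ D * r * m * (m - n)
    q∣tail with r∣m
    ... | divides k m≡kr = subst (+ q ∣ₛ_)
      (trans (lemma D r k m n) (cong (λ u → D * r * u * (m - n)) (sym m≡kr)))
      (∣m⇒∣m*n _ q∣r*r)

  module Shear (A B C D Bi : ℤ) where

    a c E α β γ : ℤ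
    a = Bi * A
    c = Bi * C
    E = Bi * D
    -- α, γ cancel the n-affine part and β the m-linear part of shifted-square-mod-4.
    α = - (E * (a * a + a + + 2 * a * c + c))
    β = + 2 * E * (a + c)
    γ = - (E * (c * c))

    shearA shearB shearC normalD : ℤ
    shearA  = - a + α * r
    shearB  = Bi * (+ 1 + β * r)
    shearC  = - c + γ * r
    normalD = E * (+ 1 + + 2 * a)

    shearB-odd : B * Bi ≡ + 1 ⟨mod q ⟩ → Odd shearB
    shearB-odd BBi≡1 = Odd-* {Bi} (Odd-*-cancelˡ {B} (Odd-≡-mod 2∣q BBi≡1 Odd-1))
      (Odd-≡-mod {q = 2} ∣-refl (+-multiple-mod (+ 1) (∣n⇒∣m*n β 2∣r)) Odd-1)

    shear-normalises : B * Bi ≡ + 1 ⟨mod q ⟩ → ∀ n m →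
      shearB * ψ r A B C D n (m + shearA * n + shearC) ≡ m + normalD * r * m * (m - n) ⟨mod q ⟩
    shear-normalises BBi≡1 n m = begin
      shearB * ψ r A B C D n x
        ≡⟨ divide-by-B u A B C D Bi r n x ⟩
      u * (x * (B * Bi) + (a * n + c + E * r * x * (x - n)))
        ≈⟨ *-congˡ-mod u (+-congʳ-mod _ (*-congˡ-mod x BBi≡1)) ⟩
      u * (x * + 1 + (a * n + c + E * r * x * (x - n)))
        ≡⟨ cong (u *_) (substitute a c E α γ r n m) ⟩
      u * (m + r * (z + E * (y * (y - n))) + r * r * (E * z * (+ 2 * y + r * z - n)))
        ≈⟨ *-congˡ-mod u (+-multiple-mod _ (∣m⇒∣m*n _ q∣r*r)) ⟩
      u * (m + r * (z + E * (y * (y - n))))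
        ≈⟨ *-congˡ-mod u (+-congˡ-mod m (r*-mod-4 reduce-mod-4)) ⟩
      u * (m + r * (normalD * (m * (m - n)) - β * m))
        ≡⟨ absorb β normalD r n m ⟩
      m + normalD * r * m * (m - n) + r * r * (β * (normalD * (m * (m - n)) - β * m))
        ≈⟨ +-multiple-mod _ (∣m⇒∣m*n _ q∣r*r) ⟩
      m + normalD * r * m * (m - n) ∎
      where
      open ≡-mod-Reasoning q
      x y z u : ℤ
      x = m + shearA * n + shearC
      y = m - a * n - c
      z = α * n + γ
      u = + 1 + β * r

      reduce-mod-4 : z + E * (y * (y - n)) ≡ normalD * (m * (m - n)) - β * m ⟨mod 4 ⟩
      reduce-mod-4 = ≡-mod-trans (+-congˡ-mod z (*-congˡ-mod E (shifted-square-mod-4 a c m n)))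
                                 (≡⇒≡-mod (cancel a c E m n))
        where
        cancel : ∀ a c E m n →
          - (E * (a * a + a + + 2 * a * c + c)) * n + - (E * (c * c))
            + E * ((+ 1 + + 2 * a) * (m * (m - n)) - + 2 * (a + c) * m
                   + ((a * a + a + + 2 * a * c + c) * n + c * c))
          ≡ E * (+ 1 + + 2 * a) * (m * (m - n)) - + 2 * E * (a + c) * m
        cancel = solve-∀

      divide-by-B : ∀ u A B C D Bi r n x →
        Bi * u * (A * n + B * x + C + D * r * x * (x - n))
          ≡ u * (x * (B * Bi) + (Bi * A * n + Bi * C + Bi * D * r * x * (x - n)))
      divide-by-B = solve-∀

      substitute : ∀ a c E α γ r n m →
        let x = m + (- a + α * r) * n + (- c + γ * r)
            y = m - a * n - c
            z = α * n + γ
        in x * + 1 + (a * n + c + E * r * x * (x - n))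
           ≡ m + r * (z + E * (y * (y - n))) + r * r * (E * z * (+ 2 * y + r * z - n))
      substitute = solve-∀

      absorb : ∀ β D r n m →
        (+ 1 + β * r) * (m + r * (D * (m * (m - n)) - β * m))
          ≡ m + D * r * m * (m - n) + r * r * (β * (D * (m * (m - n)) - β * m))
      absorb = solve-∀

  NormalShearing : (L : ℕ) → (ℕ → ℤ → ℤ) → Set
  NormalShearing L F = ∃ λ (A' : ℤ) → ∃ λ (B' : ℤ) → ∃ λ (C' : ℤ) → Odd B' × ∃ λ (D' : ℤ) →
    (∀ (n : ℕ) (m : ℤ) → 1 ≤ n → n ≤ L → ¬ ((+ q) ∣ m) →
       B' * F n (m + A' * + n + C') ≡ m + D' * r * m * (m - + n) [mod q ])

  shear-to-normal-form : ∀ L F A B C D Bi → B * Bi ≡ + 1 ⟨mod q ⟩ →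
    (∀ (n : ℕ) (m : ℤ) → 1 ≤ n → n ≤ L →
       ¬ (ψ r A B C D (+ n) m ≡ + 0 [mod q ]) → F n m ≡ ψ r A B C D (+ n) m [mod q ]) →
    NormalShearing L F
  shear-to-normal-form L F A B C D Bi BBi≡1 agree =
    shearA , shearB , shearC , shearB-odd BBi≡1 , normalD , normalised
    where
    open Shear A B C D Bi
    normalised : ∀ n m → 1 ≤ n → n ≤ L → ¬ ((+ q) ∣ m) →
      shearB * F n (m + shearA * + n + shearC) ≡ m + normalD * r * m * (m - + n) [mod q ]
    normalised n m 1≤n n≤L q∤m = ⟨mod⟩⇒[mod]
      (≡-mod-trans (*-congˡ-mod shearB ([mod]⇒⟨mod⟩ (agree n _ 1≤n n≤L ψ≢0))) normal)
      where
      normal : shearB * ψ r A B C D (+ n) (m + shearA * + n + shearC)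
                 ≡ m + normalD * r * m * (m - + n) ⟨mod q ⟩
      normal = shear-normalises BBi≡1 (+ n) m
      ψ≢0 : ¬ (ψ r A B C D (+ n) (m + shearA * + n + shearC) ≡ + 0 [mod q ])
      ψ≢0 ψ≡0 = normal-form-≢0 normalD (+ n) m q∤m
        (≡-mod-trans (≡-mod-sym normal)
          (≡-mod-trans (*-congˡ-mod shearB ([mod]⇒⟨mod⟩ ψ≡0)) (≡⇒≡-mod (ℤ.*-zeroʳ shearB))))

+2^[2+k]≡4*2^k : ∀ k → + (2 ^ (2 ℕ.+ k)) ≡ + 4 * + (2 ^ k)
+2^[2+k]≡4*2^k k = trans (cong +_ (sym (ℕ.*-assoc 2 2 (2 ^ k)))) (ℤ.pos-* 4 (2 ^ k))

Q≡4*Qquarter : ∀ k → + Q (2 ℕ.+ k) ≡ + 4 * Qquarter (2 ℕ.+ k)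
Q≡4*Qquarter = +2^[2+k]≡4*2^k

4∣Qquarter : ∀ k → + 4 ∣ₛ Qquarter (4 ℕ.+ k)
4∣Qquarter k = divides (+ (2 ^ k)) (trans (+2^[2+k]≡4*2^k k) (ℤ.*-comm (+ 4) (+ (2 ^ k))))

proposition9p6 : ∃ λ (S : ℕ) → ∀ (s : ℕ) → S ≤ s →
    ∀ (F : ℕ → ℤ → ℤ) → SudokuSolution s F →
    ∀ (A B C D : ℤ) → Odd B →
    (∀ (n : ℕ) (m : ℤ) → 1 ≤ n → n ≤ NN s →
    ¬ (Ψ s A B C D n m ≡ + 0 [mod Q s ]) → F n m ≡ Ψ s A B C D n m [mod Q s ]) →
    ∃ λ (A' : ℤ) → ∃ λ (B' : ℤ) → ∃ λ (C' : ℤ) → Odd B' × ∃ λ (D' : ℤ) →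
    (∀ (n : ℕ) (m : ℤ) → 1 ≤ n → n ≤ NN s → ¬ ((+ Q s) ∣ m) →
    B' * F n (m + A' * + n + C') ≡ m + D' * Qquarter s * m * (m - + n) [mod Q s ])
proposition9p6 = 4 , λ
  { _ (s≤s (s≤s (s≤s (s≤s (z≤n {k}))))) F _ A B C D odd agree →
      let Bi , BBi≡1 = odd⇒invertible {B} odd (3 ℕ.+ k)
      in Quarter.shear-to-normal-form (Q≡4*Qquarter (2 ℕ.+ k)) (4∣Qquarter k)
           (NN (4 ℕ.+ k)) F A B C D Bi BBi≡1 agree }
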